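{- Let $G$ be a simple connected graph with $n$ vertices, and let $G^*$ be its double graph. Then \[ C^\xi(G^*) = 4\,C^\xi(G) - 2(n-1)\,\|n-1\|_G, \] where $\|n-1\|_G$ denotes the number of vertices of $G$ of degree $n-1$ (equivalently, of eccentricity one).
   Context: For a connected graph $H$, $d_H(v)$ is the degree of $v$ and the eccentricity $\varepsilon_H(v)$ is the largest distance from $v$ to any other vertex of $H$. The connective eccentric index is $C^\xi(H)=\sum_{v\in V(H)} \frac{d_H(v)}{\varepsilon_H(v)}$. The double graph $G^*$ of a graph $G$ with $V(G)=\{v_1,\dots,v_n\}$ has vertex set $X\cup Y$, $X=\{x_1,\dots,x_n\}$, $Y=\{y_1,\dots,y_n\}$; its edges are $x_ix_j$ and $y_iy_j$ for every edge $v_iv_j\in E(G)$ (two copies of $G$), together with the two edges $x_iy_j$ and $x_jy_i$ for every edge $v_iv_j\in E(G)$. -}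

module Defs where

open import Data.Bool using (Bool; true; false; _∧_; _∨_; if_then_else_)
open import Data.Nat as ℕ using (ℕ; zero; suc; _⊔_; _≡ᵇ_)
open import Data.Fin using (Fin; splitAt)
open import Data.Sum using (inj₁; inj₂)
open import Data.Product using (∃-syntax)
open import Data.Integer using (+_)
open import Data.Rational as ℚ using (ℚ; 0ℚ; _/_)
open import Relation.Binary.PropositionalEquality using (_≡_)

Adj : ℕ → Set
Adj n = Fin n → Fin n → Bool

Symmetric : ∀ {n} → Adj n → Set
Symmetric {n} A = (i j : Fin n) → A i j ≡ A j i

Irreflexive : ∀ {n} → Adj n → Set
Irreflexive {n} A = (i : Fin n) → A i i ≡ false

Σℕ : (n : ℕ) → (Fin n → ℕ) → ℕ
Σℕ zero    f = 0
Σℕ (suc n) f = f Fin.zero ℕ.+ Σℕ n (λ i → f (Fin.suc i))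

Σℚ : (n : ℕ) → (Fin n → ℚ) → ℚ
Σℚ zero    f = 0ℚ
Σℚ (suc n) f = f Fin.zero ℚ.+ Σℚ n (λ i → f (Fin.suc i))

anyFin : (n : ℕ) → (Fin n → Bool) → Bool
anyFin zero    p = false
anyFin (suc n) p = p Fin.zero ∨ anyFin n (λ i → p (Fin.suc i))

maxFin : (n : ℕ) → (Fin n → ℕ) → ℕ
maxFin zero    f = 0
maxFin (suc n) f = f Fin.zero ⊔ maxFin n (λ i → f (Fin.suc i))

_==_ : ∀ {n} → Fin n → Fin n → Bool
Fin.zero  == Fin.zero  = true
Fin.zero  == Fin.suc j = false
Fin.suc i == Fin.zero  = false
Fin.suc i == Fin.suc j = i == j

deg : ∀ {n} → Adj n → Fin n → ℕ
deg {n} A i = Σℕ n (λ j → if A i j then 1 else 0)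

reach : ∀ {n} → Adj n → ℕ → Fin n → Fin n → Bool
reach A zero    u v = u == v
reach {n} A (suc k) u v = reach A k u v ∨ anyFin n (λ w → reach A k u w ∧ A w v)

Connected : ∀ {n} → Adj n → Set
Connected {n} A = (u v : Fin n) → ∃[ k ] (reach A k u v ≡ true)

-- least k < fuel with p k = true (returns fuel if none)
firstTrue : ℕ → (ℕ → Bool) → ℕ
firstTrue zero       p = 0
firstTrue (suc fuel) p = if p 0 then 0 else suc (firstTrue fuel (λ k → p (suc k)))

-- distance: least length of a walk from u to v.  A shortest walk in a graph
-- with n vertices has length < n, so searching below n suffices for connected graphs.
dist : ∀ {n} → Adj n → Fin n → Fin n → ℕ
dist {n} A u v = firstTrue n (λ k → reach A k u v)

ecc : ∀ {n} → Adj n → Fin n → ℕ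
ecc {n} A u = maxFin n (λ v → dist A u v)

-- d / e as a rational (e = 0 never occurs for connected graphs on ≥ 2 vertices)
frac : ℕ → ℕ → ℚ
frac d zero    = 0ℚ
frac d (suc e) = (+ d) / suc e

Cξ : ∀ {n} → Adj n → ℚ
Cξ {n} A = Σℚ n (λ v → frac (deg A v) (ecc A v))

-- double graph G* on Fin (n + n): the first n vertices are x_1..x_n, the last n are y_1..y_n.
-- x_i x_j, y_i y_j, x_i y_j and y_i x_j are edges iff v_i v_j ∈ E(G).
double : ∀ {n} → Adj n → Adj (n ℕ.+ n)
double {n} A a b with splitAt n a | splitAt n b
... | inj₁ i | inj₁ j = A i j
... | inj₁ i | inj₂ j = A i j
... | inj₂ i | inj₁ j = A i j
... | inj₂ i | inj₂ j = A i j

countDeg : ∀ {n} → Adj n → ℕ → ℕ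
countDeg {n} A d = Σℕ n (λ v → if deg A v ≡ᵇ d then 1 else 0)

module Submission where

-- Let π : V(G*) → V(G) send x_i, y_i to v_i.  Adjacency in G* is adjacency of the
-- π-images, i.e. G* is the pullback of G along π.  Walks project along π and lift
-- along π, so dist_{G*}(a,b) = dist_G(πa,πb) when πa ≠ πb, while the twin of a
-- (the other point of its fibre) lies at distance exactly 2: G is loopless, and a
-- neighbour of πa (G is connected with n ≥ 2) gives a common neighbour.  Hence
-- d_{G*}(a) = 2 d_G(πa) and ε_{G*}(a) = max(ε_G(πa), 2).  In G, ε(v) = 1 exactly when
-- d(v) = n - 1, and otherwise ε(v) ≥ 2; so every vertex v contributes
-- 2 · 2d(v)/max(ε(v),2) = 4 d(v)/ε(v) - 2(n-1)[d(v) = n-1], and we sum.  Distances are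
-- bounded searches (fuel n for G, 2n for G*), so we also show that all distances in a
-- connected graph are below n.

open import Defs
open import Data.Nat using (ℕ; _≤_; _∸_; _*_)
open import Data.Integer using (+_)
open import Data.Rational using (ℚ; _/_; _+_; _-_)
open import Relation.Binary.PropositionalEquality using (_≡_)

open import Data.Bool using (Bool; true; false; not; _∧_; _∨_; if_then_else_; T)
open import Data.Bool.Properties using (¬-not) renaming (_≟_ to _≟ᵇ_)
import Data.Nat as ℕ
open import Data.Nat using (zero; suc; _⊔_; _≡ᵇ_; _<_; _≤′_; ≤′-refl; ≤′-step; z≤n; s≤s)
import Data.Nat.Properties as ℕP
open import Data.Fin using (Fin; splitAt; _↑ˡ_; _↑ʳ_)
import Data.Fin as F
import Data.Fin.Properties as FP
open import Data.Sum using (_⊎_; inj₁; inj₂; [_,_]′)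
open import Data.Product using (∃-syntax; _×_; _,_)
open import Data.Empty using (⊥-elim)
open import Relation.Nullary using (¬_; yes; no)
open import Relation.Binary.PropositionalEquality
  using (refl; sym; trans; cong; cong₂; subst; subst₂; module ≡-Reasoning)
import Data.Integer as ℤ
import Data.Integer.Properties as ℤP
open import Data.Rational using (0ℚ; fromℚᵘ) renaming (_*_ to _·_)
import Data.Rational.Properties as ℚP
open import Data.Rational.Unnormalised as ℚᵘ using (mkℚᵘ; *≡*)
import Data.Rational.Unnormalised.Properties as ℚᵘP
open import Data.Rational.Solver using (module +-*-Solver)

∨-introˡ : ∀ {a b} → a ≡ true → a ∨ b ≡ true
∨-introˡ refl = refl

∨-introʳ : ∀ a {b} → b ≡ true → a ∨ b ≡ true
∨-introʳ true  _ = refl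
∨-introʳ false e = e

∨-elim : ∀ {a b} → a ∨ b ≡ true → a ≡ true ⊎ b ≡ true
∨-elim {true}  _ = inj₁ refl
∨-elim {false} e = inj₂ e

∧-intro : ∀ {a b} → a ≡ true → b ≡ true → a ∧ b ≡ true
∧-intro refl e = e

∧-elim : ∀ {a b} → a ∧ b ≡ true → a ≡ true × b ≡ true
∧-elim {true} e = refl , e

bool-ext : ∀ {a b} → (a ≡ true → b ≡ true) → (b ≡ true → a ≡ true) → a ≡ b
bool-ext {true}          f g = sym (f refl)
bool-ext {false} {true}  f g = g refl
bool-ext {false} {false} f g = refl

any-intro : ∀ {n} {p : Fin n → Bool} (i : Fin n) → p i ≡ true → anyFin n p ≡ true
any-intro F.zero    e = ∨-introˡ e
any-intro {p = p} (F.suc i) e = ∨-introʳ (p F.zero) (any-intro i e)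

any-elim : ∀ {n} {p : Fin n → Bool} → anyFin n p ≡ true → ∃[ i ] p i ≡ true
any-elim {suc n} e with ∨-elim e
... | inj₁ e₀ = F.zero , e₀
... | inj₂ e₊ with any-elim {n} e₊
...   | i , eᵢ = F.suc i , eᵢ

any-cong : ∀ {n} {p q : Fin n → Bool} → (∀ i → p i ≡ q i) → anyFin n p ≡ anyFin n q
any-cong {zero}  h = refl
any-cong {suc n} h = cong₂ _∨_ (h F.zero) (any-cong (λ i → h (F.suc i)))

==-refl : ∀ {n} (i : Fin n) → (i == i) ≡ true
==-refl F.zero    = refl
==-refl (F.suc i) = ==-refl i

==-sound : ∀ {n} {i j : Fin n} → (i == j) ≡ true → i ≡ j
==-sound {i = F.zero}  {F.zero}  e = refl
==-sound {i = F.suc i} {F.suc j} e = cong F.suc (==-sound e)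

==-false : ∀ {n} {i j : Fin n} → ¬ i ≡ j → (i == j) ≡ false
==-false i≢j = ¬-not (λ e → i≢j (==-sound e))

ind : Bool → ℕ
ind b = if b then 1 else 0

ind-≤1 : ∀ b → ind b ≤ 1
ind-≤1 true  = ℕP.≤-refl
ind-≤1 false = z≤n

ind-mono : ∀ {a b} → (a ≡ true → b ≡ true) → ind a ≤ ind b
ind-mono {false}   _ = z≤n
ind-mono {true}  h rewrite h refl = ℕP.≤-refl

ind≡1 : ∀ {b} → ind b ≡ 1 → b ≡ true
ind≡1 {true} _ = refl

Σ-cong : ∀ n {f g : Fin n → ℕ} → (∀ i → f i ≡ g i) → Σℕ n f ≡ Σℕ n g
Σ-cong zero    h = refl
Σ-cong (suc n) h = cong₂ ℕ._+_ (h F.zero) (Σ-cong n (λ i → h (F.suc i)))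

Σ-mono : ∀ n {f g : Fin n → ℕ} → (∀ i → f i ≤ g i) → Σℕ n f ≤ Σℕ n g
Σ-mono zero    h = z≤n
Σ-mono (suc n) h = ℕP.+-mono-≤ (h F.zero) (Σ-mono n (λ i → h (F.suc i)))

Σ-strict : ∀ n {f g : Fin n → ℕ} → (∀ i → f i ≤ g i) → (v : Fin n) → f v < g v → Σℕ n f < Σℕ n g
Σ-strict (suc n) h F.zero    lt = ℕP.+-mono-<-≤ lt (Σ-mono n (λ i → h (F.suc i)))
Σ-strict (suc n) h (F.suc v) lt = ℕP.+-mono-≤-< (h F.zero) (Σ-strict n (λ i → h (F.suc i)) v lt)

Σ-eq-pointwise : ∀ n {f g : Fin n → ℕ} → (∀ i → f i ≤ g i) → Σℕ n f ≡ Σℕ n g → ∀ i → f i ≡ g i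
Σ-eq-pointwise n h eq i with ℕP.m≤n⇒m<n∨m≡n (h i)
... | inj₁ lt = ⊥-elim (ℕP.<-irrefl eq (Σ-strict n h i lt))
... | inj₂ e  = e

Σ-term : ∀ n (f : Fin n → ℕ) (i : Fin n) → f i ≤ Σℕ n f
Σ-term (suc n) f F.zero    = ℕP.m≤m+n _ _
Σ-term (suc n) f (F.suc i) = ℕP.≤-trans (Σ-term n (λ j → f (F.suc j)) i) (ℕP.m≤n+m _ _)

Σ-ones : ∀ n → Σℕ n (λ _ → 1) ≡ n
Σ-ones zero    = refl
Σ-ones (suc n) = cong suc (Σ-ones n)

Σ-others : ∀ n (u : Fin n) → Σℕ n (λ v → ind (not (v == u))) ≡ n ∸ 1
Σ-others (suc n)       F.zero    = Σ-ones n
Σ-others (suc (suc n)) (F.suc u) = cong suc (Σ-others (suc n) u)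

Σ-split : ∀ n m (f : Fin (n ℕ.+ m) → ℕ) →
  Σℕ (n ℕ.+ m) f ≡ Σℕ n (λ i → f (i ↑ˡ m)) ℕ.+ Σℕ m (λ j → f (n ↑ʳ j))
Σ-split zero    m f = refl
Σ-split (suc n) m f = trans (cong (f F.zero ℕ.+_) (Σ-split n m (λ i → f (F.suc i))))
                            (sym (ℕP.+-assoc (f F.zero) _ _))

Σ-* : ∀ n c (f : Fin n → ℕ) → Σℕ n (λ i → c * f i) ≡ c * Σℕ n f
Σ-* zero    c f = sym (ℕP.*-zeroʳ c)
Σ-* (suc n) c f = trans (cong (c * f F.zero ℕ.+_) (Σ-* n c (λ i → f (F.suc i))))
                        (sym (ℕP.*-distribˡ-+ c (f F.zero) _))

maxFin-upper : ∀ n (f : Fin n → ℕ) (i : Fin n) → f i ≤ maxFin n f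
maxFin-upper (suc n) f F.zero    = ℕP.m≤m⊔n _ _
maxFin-upper (suc n) f (F.suc i) = ℕP.≤-trans (maxFin-upper n (λ j → f (F.suc j)) i) (ℕP.m≤n⊔m _ _)

maxFin-lub : ∀ n (f : Fin n → ℕ) c → (∀ i → f i ≤ c) → maxFin n f ≤ c
maxFin-lub zero    f c h = z≤n
maxFin-lub (suc n) f c h = ℕP.⊔-lub (h F.zero) (maxFin-lub n (λ j → f (F.suc j)) c (λ j → h (F.suc j)))

firstTrue-cong : ∀ f {p q : ℕ → Bool} → (∀ k → p k ≡ q k) → firstTrue f p ≡ firstTrue f q
firstTrue-cong zero    h = refl
firstTrue-cong (suc f) {p} {q} h
  rewrite h 0 | firstTrue-cong f {λ k → p (suc k)} {λ k → q (suc k)} (λ k → h (suc k)) = refl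

firstTrue-≤ : ∀ f (p : ℕ → Bool) k → p k ≡ true → firstTrue f p ≤ k
firstTrue-≤ zero    p k       e = z≤n
firstTrue-≤ (suc f) p zero    e rewrite e = z≤n
firstTrue-≤ (suc f) p (suc k) e with p 0
... | true  = z≤n
... | false = s≤s (firstTrue-≤ f (λ j → p (suc j)) k e)

firstTrue-true : ∀ f (p : ℕ → Bool) → firstTrue f p < f → p (firstTrue f p) ≡ true
firstTrue-true (suc f) p lt with p 0 in p0
... | true  = p0
... | false = firstTrue-true f (λ j → p (suc j)) (ℕP.≤-pred lt)

firstTrue-exact : ∀ f (p : ℕ → Bool) k → k < f → p k ≡ true → (∀ j → j < k → p j ≡ false) →
  firstTrue f p ≡ k
firstTrue-exact (suc f) p zero    _         pk _ rewrite pk = refl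
firstTrue-exact (suc f) p (suc k) (s≤s k<f) pk below rewrite below 0 (s≤s z≤n) =
  cong suc (firstTrue-exact f (λ j → p (suc j)) k k<f pk (λ j j<k → below (suc j) (s≤s j<k)))

firstTrue-fuel : ∀ f g (p : ℕ → Bool) k → p k ≡ true → k < f → f ≤ g → firstTrue f p ≡ firstTrue g p
firstTrue-fuel f g p k pk k<f f≤g = sym (firstTrue-exact g p j (ℕP.<-≤-trans j<f f≤g) pj below)
  where
  j : ℕ
  j = firstTrue f p
  j<f : j < f
  j<f = ℕP.≤-<-trans (firstTrue-≤ f p k pk) k<f
  pj : p j ≡ true
  pj = firstTrue-true f p j<f
  below : ∀ i → i < j → p i ≡ false
  below i i<j = ¬-not (λ pi → ℕP.<⇒≱ i<j (firstTrue-≤ f p i pi))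

module Reach {n} (A : Adj n) where

  reach-suc : ∀ {k u v} → reach A k u v ≡ true → reach A (suc k) u v ≡ true
  reach-suc {k} {u} {v} e = ∨-introˡ {b = anyFin n (λ w → reach A k u w ∧ A w v)} e

  reach-step : ∀ {k u v} w → reach A k u w ≡ true → A w v ≡ true → reach A (suc k) u v ≡ true
  reach-step {k} {u} {v} w r a = ∨-introʳ (reach A k u v) (any-intro w (∧-intro r a))

  reach-unfold : ∀ k u v → reach A (suc k) u v ≡ true →
    reach A k u v ≡ true ⊎ ∃[ w ] (reach A k u w ≡ true × A w v ≡ true)
  reach-unfold k u v e with ∨-elim {reach A k u v} e
  ... | inj₁ r = inj₁ r
  ... | inj₂ r with any-elim {p = λ w → reach A k u w ∧ A w v} r
  ...   | w , rw with ∧-elim {reach A k u w} rw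
  ...     | r′ , a = inj₂ (w , r′ , a)

  reach-mono : ∀ {j k u v} → j ≤ k → reach A j u v ≡ true → reach A k u v ≡ true
  reach-mono {j} {u = u} {v} j≤k e = go (ℕP.≤⇒≤′ j≤k)
    where
    go : ∀ {k} → j ≤′ k → reach A k u v ≡ true
    go ≤′-refl               = e
    go {suc k} (≤′-step j≤k) = reach-suc {k} {u} {v} (go j≤k)

  reach-refl : ∀ k u → reach A k u u ≡ true
  reach-refl k u = reach-mono {0} {k} {u} {u} z≤n (==-refl u)

  reach-adj : ∀ {u v} → A u v ≡ true → reach A 1 u v ≡ true
  reach-adj {u} {v} a = reach-step {0} {u} {v} u (==-refl u) a

  reach-one : ∀ {u v} → reach A 1 u v ≡ true → u ≡ v ⊎ A u v ≡ true
  reach-one {u} {v} e with reach-unfold 0 u v e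
  ... | inj₁ r           = inj₁ (==-sound {i = u} {v} r)
  ... | inj₂ (w , r , a) = inj₂ (subst (λ x → A x v ≡ true) (sym (==-sound {i = u} {w} r)) a)

  first-step : ∀ k {u v} → reach A k u v ≡ true → ¬ u ≡ v → ∃[ w ] A u w ≡ true
  first-step zero    {u} {v} e u≢v = ⊥-elim (u≢v (==-sound {i = u} {v} e))
  first-step (suc k) {u} {v} e u≢v with reach-unfold k u v e
  ... | inj₁ r = first-step k {u} {v} r u≢v
  ... | inj₂ (w , r , a) with u FP.≟ w
  ...   | yes refl = v , a
  ...   | no u≢w   = first-step k {u} {w} r u≢w

dist-self : ∀ {n} (A : Adj n) u → dist A u u ≡ 0
dist-self {suc n} A u = firstTrue-exact (suc n) (λ k → reach A k u u) 0 (s≤s z≤n) (==-refl u) (λ _ ())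

-- Short walks: in a graph on n' + 1 vertices, whatever is reachable from u is
-- reachable within n' steps, since the reachable set grows until it closes.

module ShortWalks {n'} (A : Adj (suc n')) (u : Fin (suc n')) where
  open Reach A

  reached : ℕ → ℕ
  reached k = Σℕ (suc n') (λ v → ind (reach A k u v))

  Closed : ℕ → Set
  Closed k = ∀ m v → reach A m u v ≡ true → reach A k u v ≡ true

  stable⇒closed : ∀ k → (∀ v → reach A (suc k) u v ≡ reach A k u v) → Closed k
  stable⇒closed k stable m v e with ℕP.≤-total m k
  ... | inj₁ m≤k = reach-mono {m} {k} {u} {v} m≤k e
  ... | inj₂ k≤m = trans (sym (stays (m ∸ k) v))
                         (subst (λ x → reach A x u v ≡ true) (sym (ℕP.m∸n+n≡m k≤m)) e)
    where
    stays : ∀ d v → reach A (d ℕ.+ k) u v ≡ reach A k u v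
    stays zero    v = refl
    stays (suc d) v = trans (cong₂ _∨_ (stays d v) (any-cong (λ w → cong (_∧ A w v) (stays d w))))
                            (stable v)

  grows-or-closed : ∀ k → k < reached k ⊎ Closed k
  grows-or-closed zero =
    inj₁ (ℕP.≤-trans (ind-mono {true} (λ _ → ==-refl u)) (Σ-term _ (λ v → ind (reach A 0 u v)) u))
  grows-or-closed (suc k) with grows-or-closed k
  ... | inj₂ closed = inj₂ (λ m v e → reach-suc {k} {u} {v} (closed m v e))
  ... | inj₁ k<r with FP.all? (λ v → reach A (suc k) u v ≟ᵇ reach A k u v)
  ...   | yes stable = inj₂ (λ m v e → reach-suc {k} {u} {v} (stable⇒closed k stable m v e))
  ...   | no unstable with FP.¬∀⟶∃¬ _ _ (λ v → reach A (suc k) u v ≟ᵇ reach A k u v) unstable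
  ...     | v , changed = inj₁ (ℕP.≤-trans (s≤s k<r) (Σ-strict _ (λ w → ind-mono (reach-suc {k} {u} {w})) v grew))
    where
    old : reach A k u v ≡ false
    old = ¬-not (λ e → changed (trans (reach-suc {k} {u} {v} e) (sym e)))
    new : reach A (suc k) u v ≡ true
    new = ¬-not (λ e → changed (trans e (sym old)))
    grew : ind (reach A k u v) < ind (reach A (suc k) u v)
    grew = subst₂ (λ a b → ind a < ind b) (sym old) (sym new) (s≤s z≤n)

  within : Connected A → ∀ v → reach A n' u v ≡ true
  within conn v with reach A n' u v in eq
  ... | true  = refl
  ... | false with grows-or-closed n'
  ...   | inj₂ closed with conn u v
  ...     | m , e = trans (sym eq) (closed m v e)
  within conn v | false | inj₁ n'<r = ⊥-elim (ℕP.<⇒≱ n'<r (ℕP.≤-pred missing))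
    where
    missing : reached n' < suc n'
    missing = subst (reached n' <_) (Σ-ones (suc n'))
                (Σ-strict _ (λ w → ind-≤1 (reach A n' u w)) v
                  (subst (λ b → ind b < 1) (sym eq) (s≤s z≤n)))

-- Pullback graphs: D on Fin m with D a b = A (π a) (π b) for a map π with a section.
-- Walks project along π, lift along π, and may end at any point of the target fibre.

module Pullback {m n} (A : Adj n) (D : Adj m) (π : Fin m → Fin n) (σ : Fin n → Fin m)
                (π∘σ : ∀ v → π (σ v) ≡ v) (D≡A : ∀ a b → D a b ≡ A (π a) (π b)) where
  module RA = Reach A
  module RD = Reach D

  reach-project : ∀ k {a b} → reach D k a b ≡ true → reach A k (π a) (π b) ≡ true
  reach-project zero    {a} {b} e =
    subst (λ x → reach A 0 (π a) (π x) ≡ true) (==-sound {i = a} {b} e) (==-refl (π a))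
  reach-project (suc k) {a} {b} e with RD.reach-unfold k a b e
  ... | inj₁ r           = RA.reach-suc {k} {π a} {π b} (reach-project k {a} {b} r)
  ... | inj₂ (c , r , d) =
    RA.reach-step {k} {π a} {π b} (π c) (reach-project k {a} {c} r) (trans (sym (D≡A c b)) d)

  reach-lift : ∀ k {a v} → reach A k (π a) v ≡ true → ∃[ b ] (π b ≡ v × reach D k a b ≡ true)
  reach-lift zero    {a} {v} e = a , ==-sound {i = π a} {v} e , ==-refl a
  reach-lift (suc k) {a} {v} e with RA.reach-unfold k (π a) v e
  ... | inj₁ r = lifted (reach-lift k {a} {v} r)
    where
    lifted : ∃[ b ] (π b ≡ v × reach D k a b ≡ true) → ∃[ b ] (π b ≡ v × reach D (suc k) a b ≡ true)
    lifted (b , πb , r′) = b , πb , RD.reach-suc {k} {a} {b} r′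
  ... | inj₂ (w , r , x) = extended (reach-lift k {a} {w} r)
    where
    extended : ∃[ c ] (π c ≡ w × reach D k a c ≡ true) → ∃[ b ] (π b ≡ v × reach D (suc k) a b ≡ true)
    extended (c , refl , r′) =
      σ v , π∘σ v ,
      RD.reach-step {k} {a} {σ v} c r′ (trans (D≡A c (σ v)) (subst (λ z → A (π c) z ≡ true) (sym (π∘σ v)) x))

  -- points in the same fibre have the same in-neighbours, so walks may be redirected
  reach-fibre : ∀ k {a b b′} → π b ≡ π b′ → ¬ a ≡ b′ → reach D k a b′ ≡ true → reach D k a b ≡ true
  reach-fibre zero    {a} {b} {b′} _ a≢b′ e = ⊥-elim (a≢b′ (==-sound {i = a} {b′} e))
  reach-fibre (suc k) {a} {b} {b′} πb≡πb′ a≢b′ e with RD.reach-unfold k a b′ e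
  ... | inj₁ r           = RD.reach-suc {k} {a} {b} (reach-fibre k {a} {b} {b′} πb≡πb′ a≢b′ r)
  ... | inj₂ (c , r , d) =
    RD.reach-step {k} {a} {b} c r (trans (D≡A c b) (trans (cong (A (π c)) πb≡πb′) (trans (sym (D≡A c b′)) d)))

  reach-pullback : ∀ k {a b} → ¬ π a ≡ π b → reach D k a b ≡ reach A k (π a) (π b)
  reach-pullback k {a} {b} πa≢πb = bool-ext (reach-project k {a} {b}) lift
    where
    lift : reach A k (π a) (π b) ≡ true → reach D k a b ≡ true
    lift e with reach-lift k {a} {π b} e
    ... | b′ , πb′ , r = reach-fibre k {a} {b} {b′} (sym πb′) (λ a≡b′ → πa≢πb (trans (cong π a≡b′) πb′)) r

-- The double graph as a pullback along the base map x_i, y_i ↦ v_i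

module Double {n} (A : Adj n) where

  -- vertex a of G* is x_i (a = i ↑ˡ n) or y_i (a = n ↑ʳ i); base a = v_i
  base : Fin (n ℕ.+ n) → Fin n
  base a = [ (λ i → i) , (λ i → i) ]′ (splitAt n a)

  double≡A : ∀ a b → double A a b ≡ A (base a) (base b)
  double≡A a b with splitAt n a | splitAt n b
  ... | inj₁ i | inj₁ j = refl
  ... | inj₁ i | inj₂ j = refl
  ... | inj₂ i | inj₁ j = refl
  ... | inj₂ i | inj₂ j = refl

  base-x : ∀ v → base (v ↑ˡ n) ≡ v
  base-x v rewrite FP.splitAt-↑ˡ n v n = refl

  base-y : ∀ v → base (n ↑ʳ v) ≡ v
  base-y v rewrite FP.splitAt-↑ʳ n n v = refl

  twin : Fin (n ℕ.+ n) → Fin (n ℕ.+ n)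
  twin a = [ (λ i → n ↑ʳ i) , (λ i → i ↑ˡ n) ]′ (splitAt n a)

  base-twin : ∀ a → base (twin a) ≡ base a
  base-twin a with splitAt n a
  ... | inj₁ i = base-y i
  ... | inj₂ i = base-x i

  twin≢ : ∀ a → ¬ twin a ≡ a
  twin≢ a eq with splitAt n a in e
  ... | inj₁ i with trans (sym (FP.splitAt-↑ʳ n n i)) (trans (cong (splitAt n) eq) e)
  ...   | ()
  twin≢ a eq | inj₂ i with trans (sym (FP.splitAt-↑ˡ n i n)) (trans (cong (splitAt n) eq) e)
  ...   | ()

  open Pullback A (double A) base (_↑ˡ n) base-x double≡A public

  -- each vertex of G* sees both copies of each neighbour of its base
  deg-double : ∀ a → deg (double A) a ≡ 2 * deg A (base a)
  deg-double a =
    trans (Σ-split n n (λ b → ind (double A a b)))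
      (trans (cong₂ ℕ._+_ (Σ-cong n (copy (_↑ˡ n) base-x)) (Σ-cong n (copy (n ↑ʳ_) base-y)))
             (cong (deg A (base a) ℕ.+_) (sym (ℕP.+-identityʳ (deg A (base a))))))
    where
    copy : (ι : Fin n → Fin (n ℕ.+ n)) → (∀ v → base (ι v) ≡ v) →
           ∀ i → ind (double A a (ι i)) ≡ ind (A (base a) i)
    copy ι base∘ι i = cong ind (trans (double≡A a (ι i)) (cong (A (base a)) (base∘ι i)))

-- Distances and eccentricities in a connected simple graph with n' + 1 ≥ 2 vertices

module ConnectedGraph {n'} (1≤n' : 1 ≤ n') (A : Adj (suc n')) (symA : Symmetric A)
                      (irrA : Irreflexive A) (conn : Connected A) where
  n : ℕ
  n = suc n'

  open Reach A

  another : (u : Fin n) → ∃[ v ] ¬ v ≡ u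
  another F.zero    = F.suc (F.fromℕ< 1≤n') , λ ()
  another (F.suc u) = F.zero , λ ()

  neighbour : ∀ u → ∃[ w ] A u w ≡ true
  neighbour u with another u
  ... | v , v≢u with conn u v
  ...   | k , r = first-step k {u} {v} r (λ u≡v → v≢u (sym u≡v))

  adj⇒≢ : ∀ {u v} → A u v ≡ true → ¬ u ≡ v
  adj⇒≢ {u} a refl with trans (sym (irrA u)) a
  ... | ()

  dist-≤ : ∀ {u v} k → reach A k u v ≡ true → dist A u v ≤ k
  dist-≤ {u} {v} k = firstTrue-≤ n (λ j → reach A j u v) k

  dist-< : ∀ u v → dist A u v < n
  dist-< u v = s≤s (dist-≤ n' (ShortWalks.within A u conn v))

  dist-reaches : ∀ u v → reach A (dist A u v) u v ≡ true
  dist-reaches u v = firstTrue-true n (λ k → reach A k u v) (dist-< u v)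

  dist-adj : ∀ {u v} → A u v ≡ true → dist A u v ≡ 1
  dist-adj {u} {v} a = firstTrue-exact n (λ k → reach A k u v) 1 (s≤s 1≤n') (reach-adj {u} {v} a) below
    where
    below : ∀ j → j < 1 → reach A j u v ≡ false
    below zero    _         = ==-false (adj⇒≢ a)
    below (suc j) (s≤s ())

  ecc-≥1 : ∀ u → 1 ≤ ecc A u
  ecc-≥1 u with neighbour u
  ... | w , a = subst (_≤ ecc A u) (dist-adj a) (maxFin-upper n (dist A u) w)

  Dominating : Fin n → Set
  Dominating u = ∀ v → ¬ v ≡ u → A u v ≡ true

  ecc≤1⇒dominating : ∀ u → ecc A u ≤ 1 → Dominating u
  ecc≤1⇒dominating u ecc≤1 v v≢u with reach-one {u} {v} (reach-mono {dist A u v} {1} {u} {v} d≤1 (dist-reaches u v))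
    where d≤1 : dist A u v ≤ 1
          d≤1 = ℕP.≤-trans (maxFin-upper n (dist A u) v) ecc≤1
  ... | inj₁ u≡v = ⊥-elim (v≢u (sym u≡v))
  ... | inj₂ a   = a

  dominating⇒ecc≤1 : ∀ u → Dominating u → ecc A u ≤ 1
  dominating⇒ecc≤1 u dom = maxFin-lub n (dist A u) 1 (λ v → dist-≤ 1 (one-step v))
    where
    one-step : ∀ v → reach A 1 u v ≡ true
    one-step v with v FP.≟ u
    ... | yes refl = reach-refl 1 u
    ... | no v≢u   = reach-adj {u} {v} (dom v v≢u)

  adj≤other : ∀ u v → ind (A u v) ≤ ind (not (v == u))
  adj≤other u v with v FP.≟ u
  ... | yes refl rewrite irrA u = z≤n
  ... | no v≢u rewrite ==-false v≢u = ind-≤1 (A u v)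

  dominating⇒full : ∀ u → Dominating u → deg A u ≡ n ∸ 1
  dominating⇒full u dom = trans (Σ-cong n same) (Σ-others n u)
    where
    same : ∀ v → ind (A u v) ≡ ind (not (v == u))
    same v with v FP.≟ u
    ... | yes refl rewrite irrA u | ==-refl u = refl
    ... | no v≢u rewrite dom v v≢u | ==-false v≢u = refl

  full⇒dominating : ∀ u → deg A u ≡ n ∸ 1 → Dominating u
  full⇒dominating u full v v≢u =
    ind≡1 (trans (Σ-eq-pointwise n (adj≤other u) (trans full (sym (Σ-others n u))) v)
                 (cong (λ b → ind (not b)) (==-false v≢u)))

  classify : ∀ u → (ecc A u ≡ 1 × deg A u ≡ n ∸ 1) ⊎ (2 ≤ ecc A u × ¬ deg A u ≡ n ∸ 1)
  classify u with ecc A u ℕP.≤? 1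
  ... | yes ecc≤1 = inj₁ (ℕP.≤-antisym ecc≤1 (ecc-≥1 u) , dominating⇒full u (ecc≤1⇒dominating u ecc≤1))
  ... | no ecc≰1  = inj₂ (ℕP.≰⇒> ecc≰1 , λ full → ecc≰1 (dominating⇒ecc≤1 u (full⇒dominating u full)))

  open Double A public

  D : Adj (n ℕ.+ n)
  D = double A

  dist-across : ∀ a b → ¬ base a ≡ base b → dist D a b ≡ dist A (base a) (base b)
  dist-across a b ne =
    trans (firstTrue-cong (n ℕ.+ n) (λ k → reach-pullback k {a} {b} ne))
          (sym (firstTrue-fuel n (n ℕ.+ n) (λ k → reach A k (base a) (base b)) n'
                 (ShortWalks.within A (base a) conn (base b)) ℕP.≤-refl (ℕP.m≤m+n n n)))

  -- distinct points of one fibre are non-adjacent with a common neighbour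
  dist-fibre : ∀ a b → ¬ a ≡ b → base a ≡ base b → dist D a b ≡ 2
  dist-fibre a b a≢b same = firstTrue-exact (n ℕ.+ n) (λ k → reach D k a b) 2 2<2n two below
    where
    2<2n : 2 < n ℕ.+ n
    2<2n = s≤s (ℕP.≤-trans (s≤s 1≤n') (ℕP.m≤n+m (suc n') n'))
    no-edge : D a b ≡ false
    no-edge = trans (double≡A a b) (trans (cong (A (base a)) (sym same)) (irrA (base a)))
    below : ∀ j → j < 2 → reach D j a b ≡ false
    below zero          _ = ==-false a≢b
    below (suc zero)    _ = ¬-not one-step
      where
      one-step : ¬ reach D 1 a b ≡ true
      one-step e with RD.reach-one {a} {b} e
      ... | inj₁ a≡b = a≢b a≡b
      ... | inj₂ d with trans (sym no-edge) d
      ...   | ()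
    below (suc (suc j)) (s≤s (s≤s ()))
    two : reach D 2 a b ≡ true
    two with neighbour (base a)
    ... | w , aw = RD.reach-step {1} {a} {b} (w ↑ˡ n) (RD.reach-adj {a} {w ↑ˡ n} out) back
      where
      out : D a (w ↑ˡ n) ≡ true
      out = trans (double≡A a (w ↑ˡ n)) (trans (cong (A (base a)) (base-x w)) aw)
      back : D (w ↑ˡ n) b ≡ true
      back = trans (double≡A (w ↑ˡ n) b)
               (trans (cong₂ A (base-x w) (sym same)) (trans (symA w (base a)) aw))

  ecc-double : ∀ a → ecc D a ≡ ecc A (base a) ⊔ 2
  ecc-double a = ℕP.≤-antisym (maxFin-lub (n ℕ.+ n) (dist D a) _ upper)
                              (ℕP.⊔-lub (maxFin-lub n (dist A (base a)) _ lower) twin-far)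
    where
    e : ℕ
    e = ecc A (base a) ⊔ 2
    upper : ∀ b → dist D a b ≤ e
    upper b with b FP.≟ a
    ... | yes refl = subst (_≤ e) (sym (dist-self D a)) z≤n
    ... | no b≢a with base a FP.≟ base b
    ...   | yes same = subst (_≤ e) (sym (dist-fibre a b (λ a≡b → b≢a (sym a≡b)) same)) (ℕP.m≤n⊔m _ 2)
    ...   | no ne    = subst (_≤ e) (sym (dist-across a b ne))
                         (ℕP.≤-trans (maxFin-upper n (dist A (base a)) (base b)) (ℕP.m≤m⊔n _ 2))
    lower : ∀ v → dist A (base a) v ≤ ecc D a
    lower v with base a FP.≟ v
    ... | yes refl = subst (_≤ ecc D a) (sym (dist-self A (base a))) z≤n
    ... | no ne    = subst (_≤ ecc D a) (trans (dist-across a (v ↑ˡ n) ne′) (cong (dist A (base a)) (base-x v)))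
                       (maxFin-upper (n ℕ.+ n) (dist D a) (v ↑ˡ n))
      where ne′ : ¬ base a ≡ base (v ↑ˡ n)
            ne′ eq = ne (trans eq (base-x v))
    twin-far : 2 ≤ ecc D a
    twin-far = subst (_≤ ecc D a) (dist-fibre a (twin a) (λ e → twin≢ a (sym e)) (sym (base-twin a)))
                 (maxFin-upper (n ℕ.+ n) (dist D a) (twin a))

fromℚᵘ-+ : ∀ p q → fromℚᵘ (p ℚᵘ.+ q) ≡ fromℚᵘ p + fromℚᵘ q
fromℚᵘ-+ p q = ℚP.toℚᵘ-injective (ℚᵘP.≃-trans (ℚP.toℚᵘ-fromℚᵘ (p ℚᵘ.+ q))
   (ℚᵘP.≃-trans (ℚᵘP.+-cong (ℚᵘP.≃-sym (ℚP.toℚᵘ-fromℚᵘ p)) (ℚᵘP.≃-sym (ℚP.toℚᵘ-fromℚᵘ q)))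
     (ℚᵘP.≃-sym (ℚP.toℚᵘ-homo-+ (fromℚᵘ p) (fromℚᵘ q)))))

fromℚᵘ-* : ∀ p q → fromℚᵘ (p ℚᵘ.* q) ≡ fromℚᵘ p · fromℚᵘ q
fromℚᵘ-* p q = ℚP.toℚᵘ-injective (ℚᵘP.≃-trans (ℚP.toℚᵘ-fromℚᵘ (p ℚᵘ.* q))
   (ℚᵘP.≃-trans (ℚᵘP.*-cong (ℚᵘP.≃-sym (ℚP.toℚᵘ-fromℚᵘ p)) (ℚᵘP.≃-sym (ℚP.toℚᵘ-fromℚᵘ q)))
     (ℚᵘP.≃-sym (ℚP.toℚᵘ-homo-* (fromℚᵘ p) (fromℚᵘ q)))))

ℕ/1-+ : ∀ a b → (+ (a ℕ.+ b)) / 1 ≡ (+ a) / 1 + (+ b) / 1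
ℕ/1-+ a b = trans (ℚP.fromℚᵘ-cong {mkℚᵘ (+ (a ℕ.+ b)) 0} {mkℚᵘ (+ a) 0 ℚᵘ.+ mkℚᵘ (+ b) 0} (*≡* eq))
                  (fromℚᵘ-+ (mkℚᵘ (+ a) 0) (mkℚᵘ (+ b) 0))
  where
  eq : (+ (a ℕ.+ b)) ℤ.* + 1 ≡ ((+ a) ℤ.* + 1 ℤ.+ (+ b) ℤ.* + 1) ℤ.* + 1
  eq rewrite ℤP.*-identityʳ (+ (a ℕ.+ b)) | ℤP.*-identityʳ (+ a) | ℤP.*-identityʳ (+ b)
           | ℤP.*-identityʳ (+ a ℤ.+ + b) = ℤP.pos-+ a b

scale : ∀ k d e → (+ (k * d)) / suc e ≡ (+ k) / 1 · ((+ d) / suc e)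
scale k d e = trans (ℚP.fromℚᵘ-cong {mkℚᵘ (+ (k * d)) e} {mkℚᵘ (+ k) 0 ℚᵘ.* mkℚᵘ (+ d) e} (*≡* eq))
                    (fromℚᵘ-* (mkℚᵘ (+ k) 0) (mkℚᵘ (+ d) e))
  where
  eq : (+ (k * d)) ℤ.* + (1 * suc e) ≡ ((+ k) ℤ.* (+ d)) ℤ.* + suc e
  eq = cong₂ ℤ._*_ (ℤP.pos-* k d) (cong +_ (ℕP.*-identityˡ (suc e)))

halve : ∀ d → (+ d) / 1 ≡ (+ 2) / 1 · ((+ d) / 2)
halve d = trans (ℚP.fromℚᵘ-cong {mkℚᵘ (+ d) 0} {mkℚᵘ (+ 2) 0 ℚᵘ.* mkℚᵘ (+ d) 1} (*≡* eq))
                (fromℚᵘ-* (mkℚᵘ (+ 2) 0) (mkℚᵘ (+ d) 1))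
  where
  eq : (+ d) ℤ.* + 2 ≡ ((+ 2) ℤ.* (+ d)) ℤ.* + 1
  eq rewrite ℤP.*-identityʳ ((+ 2) ℤ.* (+ d)) = ℤP.*-comm (+ d) (+ 2)

open +-*-Solver

Σℚ-cong : ∀ n {f g : Fin n → ℚ} → (∀ i → f i ≡ g i) → Σℚ n f ≡ Σℚ n g
Σℚ-cong zero    h = refl
Σℚ-cong (suc n) h = cong₂ _+_ (h F.zero) (Σℚ-cong n (λ i → h (F.suc i)))

Σℚ-split : ∀ n m (f : Fin (n ℕ.+ m) → ℚ) →
  Σℚ (n ℕ.+ m) f ≡ Σℚ n (λ i → f (i ↑ˡ m)) + Σℚ m (λ j → f (n ↑ʳ j))
Σℚ-split zero    m f = sym (ℚP.+-identityˡ _)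
Σℚ-split (suc n) m f = trans (cong (λ z → f F.zero + z) (Σℚ-split n m (λ i → f (F.suc i))))
                             (sym (ℚP.+-assoc (f F.zero) _ _))

Σℚ-+ : ∀ n (f g : Fin n → ℚ) → Σℚ n (λ i → f i + g i) ≡ Σℚ n f + Σℚ n g
Σℚ-+ zero    f g = refl
Σℚ-+ (suc n) f g = trans (cong (λ z → (f F.zero + g F.zero) + z) (Σℚ-+ n (λ i → f (F.suc i)) (λ i → g (F.suc i))))
                         (interchange (f F.zero) (g F.zero) _ _)
  where
  interchange : ∀ a b x y → (a + b) + (x + y) ≡ (a + x) + (b + y)
  interchange = solve 4 (λ a b x y → (a :+ b) :+ (x :+ y) := (a :+ x) :+ (b :+ y)) refl

Σℚ-linear : ∀ n c (f : Fin n → ℚ) (g : Fin n → ℕ) →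
  Σℚ n (λ i → c · f i - (+ g i) / 1) ≡ c · Σℚ n f - (+ Σℕ n g) / 1
Σℚ-linear zero    c f g = solve 1 (λ c → con 0ℚ := c :* con 0ℚ :- con ((+ 0) / 1)) refl c
Σℚ-linear (suc n) c f g =
  trans (cong (λ z → (c · f F.zero - (+ g F.zero) / 1) + z) (Σℚ-linear n c (λ i → f (F.suc i)) (λ i → g (F.suc i))))
  (trans (regroup c (f F.zero) (Σℚ n (λ i → f (F.suc i))) ((+ g F.zero) / 1) ((+ Σℕ n (λ i → g (F.suc i))) / 1))
         (cong (λ z → c · (f F.zero + Σℚ n (λ i → f (F.suc i))) - z) (sym (ℕ/1-+ (g F.zero) _))))
  where
  regroup : ∀ c a s x y → (c · a - x) + (c · s - y) ≡ c · (a + s) - (x + y)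
  regroup = solve 5 (λ c a s x y → (c :* a :- x) :+ (c :* s :- y) := c :* (a :+ s) :- (x :+ y)) refl

≡ᵇ-refl : ∀ a → (a ≡ᵇ a) ≡ true
≡ᵇ-refl zero    = refl
≡ᵇ-refl (suc a) = ≡ᵇ-refl a

≡ᵇ-false : ∀ {a b} → ¬ a ≡ b → (a ≡ᵇ b) ≡ false
≡ᵇ-false {a} {b} a≢b = ¬-not (λ e → a≢b (ℕP.≡ᵇ⇒≡ a b (subst T (sym e) _)))

vertex-term : ∀ d e m → (e ≡ 1 × d ≡ m) ⊎ (2 ≤ e × ¬ d ≡ m) →
  frac (2 * d) (e ⊔ 2) + frac (2 * d) (e ⊔ 2) ≡ (+ 4) / 1 · frac d e - (+ (2 * m * ind (d ≡ᵇ m))) / 1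
vertex-term d .1 .d (inj₁ (refl , refl))
  rewrite ≡ᵇ-refl d | ℕP.*-identityʳ (2 * d) | scale 2 d 1 | scale 2 d 0 | halve d = lemma ((+ d) / 2)
  where
  lemma : ∀ h → (+ 2) / 1 · h + (+ 2) / 1 · h ≡ (+ 4) / 1 · ((+ 2) / 1 · h) - (+ 2) / 1 · ((+ 2) / 1 · h)
  lemma = solve 1 (λ h → con ((+ 2) / 1) :* h :+ con ((+ 2) / 1) :* h
                      := con ((+ 4) / 1) :* (con ((+ 2) / 1) :* h) :- con ((+ 2) / 1) :* (con ((+ 2) / 1) :* h)) refl
vertex-term d (suc (suc e)) m (inj₂ (_ , d≢m))
  rewrite ℕP.⊔-identityʳ e | ≡ᵇ-false d≢m | ℕP.*-zeroʳ (2 * m) | scale 2 d (suc e) = lemma ((+ d) / suc (suc e))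
  where
  lemma : ∀ y → (+ 2) / 1 · y + (+ 2) / 1 · y ≡ (+ 4) / 1 · y - (+ 0) / 1
  lemma = solve 1 (λ y → con ((+ 2) / 1) :* y :+ con ((+ 2) / 1) :* y := con ((+ 4) / 1) :* y :- con ((+ 0) / 1)) refl
vertex-term d (suc zero) m (inj₂ (s≤s () , _))

module DoubleIndex {n'} (1≤n' : 1 ≤ n') (A : Adj (suc n')) (symA : Symmetric A)
             (irrA : Irreflexive A) (conn : Connected A) where
  open ConnectedGraph 1≤n' A symA irrA conn

  contribution : Fin n → ℚ
  contribution v = frac (2 * deg A v) (ecc A v ⊔ 2)

  Cξ-double : Cξ D ≡ Σℚ n contribution + Σℚ n contribution
  Cξ-double = trans (Σℚ-split n n (λ a → frac (deg D a) (ecc D a)))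
                    (cong₂ _+_ (Σℚ-cong n (λ i → over (i ↑ˡ n) (base-x i)))
                               (Σℚ-cong n (λ i → over (n ↑ʳ i) (base-y i))))
    where
    over : ∀ a {v} → base a ≡ v → frac (deg D a) (ecc D a) ≡ contribution v
    over a refl = cong₂ frac (deg-double a) (ecc-double a)

  Cξ-formula : Cξ D ≡ ((+ 4) / 1) · Cξ A - (+ (2 * (n ∸ 1) * countDeg A (n ∸ 1))) / 1
  Cξ-formula = begin
    Cξ D
      ≡⟨ Cξ-double ⟩
    Σℚ n contribution + Σℚ n contribution
      ≡⟨ sym (Σℚ-+ n contribution contribution) ⟩
    Σℚ n (λ v → contribution v + contribution v)
      ≡⟨ Σℚ-cong n (λ v → vertex-term (deg A v) (ecc A v) (n ∸ 1) (classify v)) ⟩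
    Σℚ n (λ v → (+ 4) / 1 · frac (deg A v) (ecc A v) - (+ (c * full v)) / 1)
      ≡⟨ Σℚ-linear n ((+ 4) / 1) (λ v → frac (deg A v) (ecc A v)) (λ v → c * full v) ⟩
    (+ 4) / 1 · Cξ A - (+ Σℕ n (λ v → c * full v)) / 1
      ≡⟨ cong (λ z → (+ 4) / 1 · Cξ A - (+ z) / 1) (Σ-* n c full) ⟩
    (+ 4) / 1 · Cξ A - (+ (c * countDeg A (n ∸ 1))) / 1
      ∎
    where
    open ≡-Reasoning
    c : ℕ
    c = 2 * (n ∸ 1)
    full : Fin n → ℕ
    full v = ind (deg A v ≡ᵇ (n ∸ 1))

theorem1 : (n : ℕ) → 2 ≤ n → (A : Adj n) → Symmetric A → Irreflexive A → Connected A →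
    Cξ (double A) ≡ ((+ 4) / 1) Data.Rational.* Cξ A - (+ (2 * (n ∸ 1) * countDeg A (n ∸ 1))) / 1
theorem1 (suc (suc k)) (s≤s (s≤s _)) A symA irrA conn = DoubleIndex.Cξ-formula (s≤s z≤n) A symA irrA conn
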